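{- For each integer $n\geq1$, $\mathrm{ap}\mathsf{AHT}^n\leq_{\mathrm{sW}}\mathsf{RT}^{n+1}$.
   Context: For a positive integer $x$, $\lambda(x)$ and $\mu(x)$ denote the smallest and largest positions of a nonzero digit in the binary expansion of $x$ (positions counted from $0$ at the least significant digit). A sequence $\langle x_n\rangle$ satisfies the apartness condition if $\mu(x_n)<\lambda(x_{n+1})$ for all $n$. For a positive integer $k$ we identify $k$ with $\{0,\dots,k-1\}$; $[\mathbb N]^m$ is the set of $m$-element subsets of $\mathbb N$. $\mathsf{RT}^m$ is the problem whose instances are colourings $c:[\mathbb N]^m\to k$ (any finite $k$) and whose solutions are infinite $X\subseteq\mathbb N$ with $[X]^m$ $c$-monochromatic. For a sequence $\vec x=\langle x_n\rangle$ and $n\ge1$, $\mathrm{AFS}^n(\vec x)=\{(\sum_{k=k_0}^{k_1}x_k,\sum_{k=k_1+1}^{k_2}x_k,\dots,\sum_{k=k_{n-1}+1}^{k_n}x_k) : k_0\leq k_1<\cdots<k_n\}$. $\mathrm{ap}\mathsf{AHT}^n$ is the problem whose instances are colourings $c:\mathbb N^n\to k$ and whose solutions are infinite sets $Y\subseteq\mathbb N$ whose increasing enumeration $\vec y$ satisfies the apartness condition and such that $\mathrm{AFS}^n(\vec y)$ is $c$-monochromatic. $P\leq_{\mathrm{sW}}Q$ means there are Turing functionals $\Phi,\Psi$ such that for every instance $X$ of $P$, $\Phi^X$ is an instance of $Q$, and for every solution $Y$ to $\Phi^X$, $\Psi^{Y}$ is a solution to $X$. -}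

module Defs where

open import Data.Nat using (ℕ; zero; suc; _+_; _*_; _∸_; _^_; _≤_; _<_; _/_; _%_)
open import Data.Fin using (Fin)
open import Data.Vec using (Vec; []; _∷_; lookup)
open import Data.Vec.Relation.Unary.All using (All)
open import Data.Bool using (Bool; true; false; if_then_else_)
open import Data.Product using (Σ; _×_; _,_)
open import Data.Unit using (⊤)
open import Relation.Binary.PropositionalEquality using (_≡_)

-- Oracle computations (μ-recursive functions relative to an oracle
-- α : ℕ → ℕ).  These are exactly the Turing functionals.

data Code : ℕ → Set where
  zer  : ∀ {n} → Code n
  sucC : Code 1
  proj : ∀ {n} → Fin n → Code n
  orc  : Code 1
  comp : ∀ {k m} → Code k → Vec (Code m) k → Code m
  prec : ∀ {n} → Code n → Code (suc (suc n)) → Code (suc n)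
  mu   : ∀ {n} → Code (suc n) → Code n

data Eval (α : ℕ → ℕ) : {n : ℕ} → Code n → Vec ℕ n → ℕ → Set
data EvalAll (α : ℕ → ℕ) : {k m : ℕ} → Vec (Code m) k → Vec ℕ m → Vec ℕ k → Set

data Eval α where
  ev-zer  : ∀ {n} {xs : Vec ℕ n} → Eval α zer xs 0
  ev-suc  : ∀ {x} → Eval α sucC (x ∷ []) (suc x)
  ev-proj : ∀ {n} {i : Fin n} {xs} → Eval α (proj i) xs (lookup xs i)
  ev-orc  : ∀ {x} → Eval α orc (x ∷ []) (α x)
  ev-comp : ∀ {k m} {f : Code k} {gs : Vec (Code m) k} {xs ys z} →
            EvalAll α gs xs ys → Eval α f ys z → Eval α (comp f gs) xs z
  ev-prec0 : ∀ {n} {f : Code n} {g} {xs z} →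
             Eval α f xs z → Eval α (prec f g) (0 ∷ xs) z
  ev-precS : ∀ {n} {f : Code n} {g} {xs y z w} →
             Eval α (prec f g) (y ∷ xs) z → Eval α g (y ∷ z ∷ xs) w →
             Eval α (prec f g) (suc y ∷ xs) w
  ev-mu   : ∀ {n} {f : Code (suc n)} {xs y} →
            Eval α f (y ∷ xs) 0 →
            (∀ z → z < y → Σ ℕ (λ v → Eval α f (z ∷ xs) (suc v))) →
            Eval α (mu f) xs y

data EvalAll α where
  []  : ∀ {m} {xs : Vec ℕ m} → EvalAll α [] xs []
  _∷_ : ∀ {k m} {g : Code m} {gs : Vec (Code m) k} {xs y ys} →
        Eval α g xs y → EvalAll α gs xs ys → EvalAll α (g ∷ gs) xs (y ∷ ys)

Computes : (ℕ → ℕ) → Code 1 → (ℕ → ℕ) → Set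
Computes α Φ f = ∀ x → Eval α Φ (x ∷ []) (f x)

χ : (ℕ → Bool) → ℕ → ℕ
χ Y x = if Y x then 1 else 0

Infinite : (ℕ → Bool) → Set
Infinite Y = ∀ m → Σ ℕ λ x → m ≤ x × Y x ≡ true

record Problem : Set₁ where
  field
    Inst : (ℕ → ℕ) → Set
    Sol  : (ℕ → ℕ) → (ℕ → Bool) → Set
open Problem public

_≤sW_ : Problem → Problem → Set
P ≤sW Q = Σ (Code 1) λ Φ → Σ (Code 1) λ Ψ →
  ∀ α → Inst P α →
    Σ (ℕ → ℕ) λ β → Computes α Φ β × Inst Q β ×
      (∀ Y → Sol Q β Y →
         Σ (ℕ → Bool) λ Z → Computes (χ Y) Ψ (χ Z) × Sol P α Z)

-- Coding of tuples: pair x y = 2^x (2y+1) - 1 is a bijection ℕ × ℕ → ℕ.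

pair : ℕ → ℕ → ℕ
pair x y = 2 ^ x * (2 * y + 1) ∸ 1

code : ∀ {n} → Vec ℕ n → ℕ
code []       = 0
code (x ∷ xs) = pair x (code xs)

-- a colouring of ℕ^n with finitely many colours, coded by an oracle α:
-- the number of colours is α 0 and the colour of xs is α (1 + code xs)
colour : ∀ {n} → (ℕ → ℕ) → Vec ℕ n → ℕ
colour α xs = α (suc (code xs))

-- strictly increasing tuples (m-element subsets of ℕ)
Increasing : ∀ {m} → Vec ℕ m → Set
Increasing []           = ⊤
Increasing (x ∷ [])     = ⊤
Increasing (x ∷ y ∷ xs) = x < y × Increasing (y ∷ xs)

RT : ℕ → Problem
Inst (RT m) β = ∀ (xs : Vec ℕ m) → Increasing xs → colour β xs < β 0
Sol  (RT m) β Y = Infinite Y ×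
  Σ ℕ λ i → ∀ (xs : Vec ℕ m) → Increasing xs → All (λ x → Y x ≡ true) xs →
    colour β xs ≡ i

bit : ℕ → ℕ → ℕ
bit x zero    = x % 2
bit x (suc i) = bit (x / 2) i

IsLambda : ℕ → ℕ → Set
IsLambda x p = bit x p ≡ 1 × (∀ i → i < p → bit x i ≡ 0)

IsMu : ℕ → ℕ → Set
IsMu x p = bit x p ≡ 1 × (∀ i → p < i → bit x i ≡ 0)

-- μ(a) < λ(b)  (in particular a and b are positive)
MuLtLambda : ℕ → ℕ → Set
MuLtLambda a b = Σ ℕ λ p → Σ ℕ λ q → IsMu a p × IsLambda b q × p < q

Apart : (ℕ → ℕ) → Set
Apart y = ∀ n → MuLtLambda (y n) (y (suc n))

sumFrom : (ℕ → ℕ) → ℕ → ℕ → ℕ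
sumFrom y a zero    = 0
sumFrom y a (suc l) = y a + sumFrom y (suc a) l

intervalSum : (ℕ → ℕ) → ℕ → ℕ → ℕ
intervalSum y a b = sumFrom y a (suc b ∸ a)

-- bounds k_0 ≤ k_1 < k_2 < ... < k_n, given as k_0 and (k_1,...,k_n)
Bounds : ∀ {n} → ℕ → Vec ℕ n → Set
Bounds a []       = ⊤
Bounds a (b ∷ bs) = a ≤ b × Bounds (suc b) bs

afsTuple : ∀ {n} → (ℕ → ℕ) → ℕ → Vec ℕ n → Vec ℕ n
afsTuple y a []       = []
afsTuple y a (b ∷ bs) = intervalSum y a b ∷ afsTuple y (suc b) bs

AFSMono : (n : ℕ) → (ℕ → ℕ) → (ℕ → ℕ) → Set
AFSMono n α y = Σ ℕ λ i → ∀ (k₀ : ℕ) (ks : Vec ℕ n) → Bounds k₀ ks →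
  colour α (afsTuple y k₀ ks) ≡ i

StrictlyIncreasing : (ℕ → ℕ) → Set
StrictlyIncreasing y = ∀ n → y n < y (suc n)

Enumerates : (ℕ → ℕ) → (ℕ → Bool) → Set
Enumerates y Y = StrictlyIncreasing y ×
  (∀ x → (Y x ≡ true → Σ ℕ λ i → y i ≡ x) × (Σ ℕ (λ i → y i ≡ x) → Y x ≡ true))

apAHT : ℕ → Problem
Inst (apAHT n) α = ∀ (xs : Vec ℕ n) → colour α xs < α 0
Sol  (apAHT n) α Y = Infinite Y ×
  Σ (ℕ → ℕ) λ y → Enumerates y Y × Apart y × AFSMono n α y

-- A colouring c of ℕ^n is turned into the colouring
--   {x₀ < x₁ < ⋯ < xₙ} ↦ c (2^x₁ − 2^x₀, …, 2^xₙ − 2^xₙ₋₁)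
-- of [ℕ]^(n+1). If Y = {y₀ < y₁ < ⋯} is homogeneous for it, let Z consist of the
-- numbers zᵢ = 2^yᵢ₊₁ − 2^yᵢ. The binary digits of zᵢ are 1 exactly at positions
-- yᵢ, …, yᵢ₊₁ − 1, so consecutive elements of Z are apart, and sums of consecutive
-- elements telescope: z_k₀ + ⋯ + z_k₁ = 2^y_(k₁+1) − 2^y_k₀. Hence every tuple of
-- AFS^n(Z) is the image of the (n+1)-subset {y_k₀ < y_(k₁+1) < ⋯ < y_(kₙ+1)} of Y
-- and has the homogeneous colour. Z is computable from Y: x = 2^b − 2^a forces
-- b ≤ x, so x ∈ Z is a bounded search for consecutive elements a < b of Y.

module Submission where

open import Defs
open import Data.Nat
  using (ℕ; zero; suc; _+_; _*_; _∸_; _^_; _≤_; _<_; _<ᵇ_; z≤n; s≤s; s≤s⁻¹; pred; NonZero; >-nonZero)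
open import Data.Nat.Properties
open import Data.Nat.DivMod
  using (_/_; _%_; +-distrib-/; m<n⇒m/n≡0; m*n/n≡m; [m+kn]%n≡m%n; m<n⇒m%n≡m; m*n%n≡0)
open import Data.Fin using (Fin) renaming (zero to fz; suc to fs)
open import Data.Vec using (Vec; []; _∷_; lookup; map; allFin)
open import Data.Vec.Properties using (map-lookup-allFin; map-∘)
open import Data.Vec.Relation.Unary.All using (All; []; _∷_; universal)
open import Data.Vec.Relation.Unary.All.Properties using (map⁺)
open import Data.Bool using (Bool; true; false; if_then_else_)
import Data.Bool.Properties as Bool
open import Data.Product using (Σ; ∃; _×_; _,_; proj₁; proj₂)
open import Data.Sum using (_⊎_; inj₁; inj₂; [_,_]′)
open import Data.Unit using (tt)
open import Function using (id; _∘_)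
open import Relation.Nullary using (¬_; yes; no; contradiction)
open import Relation.Nullary.Decidable using (_×-dec_)
import Relation.Unary as U
open import Relation.Binary.PropositionalEquality
open import Relation.Binary.Definitions using (tri<; tri≈; tri>)

open ≡-Reasoning

sumBelow : ℕ → (ℕ → ℕ) → ℕ
sumBelow zero    f = 0
sumBelow (suc m) f = sumBelow m f + f m

dist≡0⇒≡ : ∀ m n → (m ∸ n) + (n ∸ m) ≡ 0 → m ≡ n
dist≡0⇒≡ m n eq =
  ≤-antisym (m∸n≡0⇒m≤n (m+n≡0⇒m≡0 (m ∸ n) eq)) (m∸n≡0⇒m≤n (m+n≡0⇒n≡0 (m ∸ n) eq))

1∸n≢0⇒n≡0 : ∀ n → 1 ∸ n ≢ 0 → n ≡ 0
1∸n≢0⇒n≡0 zero    _   = refl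
1∸n≢0⇒n≡0 (suc n) ≢0 = contradiction (0∸n≡0 n) ≢0

m*n≢0⇒m≢0∧n≢0 : ∀ m {n} → m * n ≢ 0 → m ≢ 0 × n ≢ 0
m*n≢0⇒m≢0∧n≢0 m {n} ≢0 =
  (λ m≡0 → ≢0 (cong (_* n) m≡0)) , (λ n≡0 → ≢0 (trans (cong (m *_) n≡0) (*-zeroʳ m)))

m≢0∧n≢0⇒m*n≢0 : ∀ {m n} → m ≢ 0 → n ≢ 0 → m * n ≢ 0
m≢0∧n≢0⇒m*n≢0 {m} m≢0 n≢0 eq = [ m≢0 , n≢0 ]′ (m*n≡0⇒m≡0∨n≡0 m eq)

sumBelow≢0⇒ : ∀ m f → sumBelow m f ≢ 0 → ∃ λ i → i < m × f i ≢ 0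
sumBelow≢0⇒ zero    f ≢0 = contradiction refl ≢0
sumBelow≢0⇒ (suc m) f ≢0 with f m ≟ 0
... | no fm≢0 = m , ≤-refl , fm≢0
... | yes fm≡0 =
  let (i , i<m , fi≢0) = sumBelow≢0⇒ m f (λ sum≡0 → ≢0 (cong₂ _+_ sum≡0 fm≡0))
  in i , m<n⇒m<1+n i<m , fi≢0

sumBelow≢0⇐ : ∀ m f {i} → i < m → f i ≢ 0 → sumBelow m f ≢ 0
sumBelow≢0⇐ (suc m) f {i} i<1+m fi≢0 eq with m≤n⇒m<n∨m≡n (s≤s⁻¹ i<1+m)
... | inj₁ i<m  = sumBelow≢0⇐ m f i<m fi≢0 (m+n≡0⇒m≡0 (sumBelow m f) eq)
... | inj₂ refl = fi≢0 (m+n≡0⇒n≡0 (sumBelow m f) eq)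

sumBelow≡0⇐ : ∀ m f → (∀ i → i < m → f i ≡ 0) → sumBelow m f ≡ 0
sumBelow≡0⇐ zero    f all≡0 = refl
sumBelow≡0⇐ (suc m) f all≡0 =
  cong₂ _+_ (sumBelow≡0⇐ m f (λ i i<m → all≡0 i (m<n⇒m<1+n i<m))) (all≡0 m ≤-refl)

sumBelow≡0⇒ : ∀ m f → sumBelow m f ≡ 0 → ∀ i → i < m → f i ≡ 0
sumBelow≡0⇒ m f sum≡0 i i<m with f i ≟ 0
... | yes fi≡0 = fi≡0
... | no fi≢0  = contradiction sum≡0 (sumBelow≢0⇐ m f i<m fi≢0)

n<2^n : ∀ n → n < 2 ^ n
n<2^n zero    = s≤s z≤n
n<2^n (suc n) = +-mono-≤ (m^n>0 2 n) (≤-trans (n<2^n n) (m≤m+n (2 ^ n) 0))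

module LeastWitness {P : ℕ → Set} (P? : U.Decidable P) where

  IsLeast : ℕ → Set
  IsLeast m = P m × (∀ k → k < m → ¬ P k)

  private
    searchBelow : ∀ n → (∀ k → k < n → ¬ P k) ⊎ Σ ℕ IsLeast
    searchBelow zero = inj₁ λ _ ()
    searchBelow (suc n) with searchBelow n | P? n
    ... | inj₂ found | _      = inj₂ found
    ... | inj₁ none  | yes pn = inj₂ (n , pn , none)
    ... | inj₁ none  | no ¬pn = inj₁ λ k k<1+n →
      [ none k , (λ { refl → ¬pn }) ]′ (m≤n⇒m<n∨m≡n (s≤s⁻¹ k<1+n))

  least : ∀ {w} → P w → Σ ℕ IsLeast
  least {w} pw = [ (λ none → contradiction pw (none w ≤-refl)) , id ]′ (searchBelow (suc w))

  isLeast-unique : ∀ {a b} → IsLeast a → IsLeast b → a ≡ b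
  isLeast-unique {a} {b} (pa , a-least) (pb , b-least) with <-cmp a b
  ... | tri< a<b _ _ = contradiction pa (b-least a a<b)
  ... | tri≈ _ a≡b _ = a≡b
  ... | tri> _ _ b<a = contradiction pb (a-least b b<a)

record Computable (k : ℕ) : Set where
  constructor computable
  field
    program   : Code k
    function  : (ℕ → ℕ) → Vec ℕ k → ℕ
    evaluates : ∀ α xs → Eval α program xs (function α xs)
open Computable

constCode : ∀ {n} → ℕ → Code n
constCode zero    = zer
constCode (suc k) = comp sucC (constCode k ∷ [])

eval-const : ∀ {α n} k (xs : Vec ℕ n) → Eval α (constCode k) xs k
eval-const zero    xs = ev-zer
eval-const (suc k) xs = ev-comp (eval-const k xs ∷ []) ev-suc

addCode : Code 2
addCode = prec (proj fz) (comp sucC (proj (fs fz) ∷ []))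

eval-add : ∀ {α} m n → Eval α addCode (m ∷ n ∷ []) (m + n)
eval-add zero    n = ev-prec0 ev-proj
eval-add (suc m) n = ev-precS (eval-add m n) (ev-comp (ev-proj ∷ []) ev-suc)

mulCode : Code 2
mulCode = prec zer (comp addCode (proj (fs (fs fz)) ∷ proj (fs fz) ∷ []))

eval-mul : ∀ {α} m n → Eval α mulCode (m ∷ n ∷ []) (m * n)
eval-mul zero    n = ev-prec0 ev-zer
eval-mul (suc m) n = ev-precS (eval-mul m n) (ev-comp (ev-proj ∷ ev-proj ∷ []) (eval-add n (m * n)))

predCode : Code 1
predCode = prec zer (proj fz)

eval-pred : ∀ {α} n → Eval α predCode (n ∷ []) (pred n)
eval-pred zero    = ev-prec0 ev-zer
eval-pred (suc n) = ev-precS (eval-pred n) ev-proj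

subtractFromCode : Code 2
subtractFromCode = prec (proj fz) (comp predCode (proj (fs fz) ∷ []))

eval-subtractFrom : ∀ {α} n m → Eval α subtractFromCode (n ∷ m ∷ []) (m ∸ n)
eval-subtractFrom zero    m = ev-prec0 ev-proj
eval-subtractFrom {α} (suc n) m =
  subst (Eval α subtractFromCode (suc n ∷ m ∷ [])) (pred[m∸n]≡m∸[1+n] m n)
    (ev-precS (eval-subtractFrom n m) (ev-comp (ev-proj ∷ []) (eval-pred (m ∸ n))))

pow2Code : Code 1
pow2Code = prec (constCode 1) (comp mulCode (constCode 2 ∷ proj (fs fz) ∷ []))

eval-pow2 : ∀ {α} n → Eval α pow2Code (n ∷ []) (2 ^ n)
eval-pow2 zero    = ev-prec0 (eval-const 1 [])
eval-pow2 (suc n) = ev-precS (eval-pow2 n) (ev-comp (eval-const 2 _ ∷ ev-proj ∷ []) (eval-mul 2 (2 ^ n)))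

sg : ℕ → ℕ
sg k = if 0 <ᵇ k then 1 else 0

sgCode : Code 1
sgCode = prec zer (constCode 1)

eval-sg : ∀ {α} n → Eval α sgCode (n ∷ []) (sg n)
eval-sg zero    = ev-prec0 ev-zer
eval-sg (suc n) = ev-precS (eval-sg n) (eval-const 1 _)

addᶜ mulᶜ monusᶜ : Computable 2
addᶜ   = computable addCode (λ { _ (m ∷ n ∷ []) → m + n }) λ { _ (m ∷ n ∷ []) → eval-add m n }
mulᶜ   = computable mulCode (λ { _ (m ∷ n ∷ []) → m * n }) λ { _ (m ∷ n ∷ []) → eval-mul m n }
monusᶜ = computable (comp subtractFromCode (proj (fs fz) ∷ proj fz ∷ [])) (λ { _ (m ∷ n ∷ []) → m ∸ n })
  λ { _ (m ∷ n ∷ []) → ev-comp (ev-proj ∷ ev-proj ∷ []) (eval-subtractFrom n m) }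

pow2ᶜ sgᶜ oracleᶜ : Computable 1
pow2ᶜ   = computable pow2Code (λ { _ (n ∷ []) → 2 ^ n }) λ { _ (n ∷ []) → eval-pow2 n }
sgᶜ     = computable sgCode (λ { _ (n ∷ []) → sg n }) λ { _ (n ∷ []) → eval-sg n }
oracleᶜ = computable orc (λ { α (n ∷ []) → α n }) λ { _ (n ∷ []) → ev-orc }

data Expr (n : ℕ) : Set where
  var  : Fin n → Expr n
  lit  : ℕ → Expr n
  app₁ : Computable 1 → Expr n → Expr n
  app₂ : Computable 2 → Expr n → Expr n → Expr n
  sumᴱ : Expr n → Expr (suc n) → Expr n

-- In sumᴱ b e, variable 0 of e is the summation index, running below b.
⟦_⟧ : ∀ {n} → Expr n → (ℕ → ℕ) → Vec ℕ n → ℕ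
⟦ var i      ⟧ α xs = lookup xs i
⟦ lit k      ⟧ α xs = k
⟦ app₁ p e   ⟧ α xs = function p α (⟦ e ⟧ α xs ∷ [])
⟦ app₂ p e f ⟧ α xs = function p α (⟦ e ⟧ α xs ∷ ⟦ f ⟧ α xs ∷ [])
⟦ sumᴱ b e   ⟧ α xs = sumBelow (⟦ b ⟧ α xs) (λ i → ⟦ e ⟧ α (i ∷ xs))

eval-projections : ∀ {α m k} (is : Vec (Fin m) k) (xs : Vec ℕ m) →
                   EvalAll α (map proj is) xs (map (lookup xs) is)
eval-projections []       xs = []
eval-projections (i ∷ is) xs = ev-proj ∷ eval-projections is xs

identityProjections : ∀ n → Vec (Code n) n
identityProjections n = map proj (allFin n)

eval-identityProjections : ∀ {α n} (xs : Vec ℕ n) → EvalAll α (identityProjections n) xs xs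
eval-identityProjections {α} {n} xs =
  subst (EvalAll α (identityProjections n) xs) (map-lookup-allFin xs) (eval-projections (allFin n) xs)

dropTwoProjections : ∀ n → Vec (Code (suc (suc n))) n
dropTwoProjections n = map proj (map (fs ∘ fs) (allFin n))

eval-dropTwoProjections : ∀ {α n} y z (xs : Vec ℕ n) →
                          EvalAll α (dropTwoProjections n) (y ∷ z ∷ xs) xs
eval-dropTwoProjections {α} {n} y z xs =
  subst (EvalAll α (dropTwoProjections n) (y ∷ z ∷ xs))
    (trans (sym (map-∘ (lookup (y ∷ z ∷ xs)) (fs ∘ fs) (allFin n))) (map-lookup-allFin xs))
    (eval-projections (map (fs ∘ fs) (allFin n)) (y ∷ z ∷ xs))

sumBelowCode : ∀ {n} → Code (suc n) → Code (suc n)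
sumBelowCode {n} c = prec zer (comp addCode (proj (fs fz) ∷ comp c (proj fz ∷ dropTwoProjections n) ∷ []))

eval-sumBelow : ∀ {α n} (c : Code (suc n)) (f : Vec ℕ (suc n) → ℕ) →
                (∀ xs → Eval α c xs (f xs)) →
                ∀ m xs → Eval α (sumBelowCode c) (m ∷ xs) (sumBelow m (λ i → f (i ∷ xs)))
eval-sumBelow c f c-evaluates zero    xs = ev-prec0 ev-zer
eval-sumBelow c f c-evaluates (suc m) xs = ev-precS (eval-sumBelow c f c-evaluates m xs)
  (ev-comp (ev-proj ∷ ev-comp (ev-proj ∷ eval-dropTwoProjections m _ xs) (c-evaluates (m ∷ xs)) ∷ [])
    (eval-add _ _))

compile : ∀ {n} → Expr n → Code n
compile (var i)      = proj i
compile (lit k)      = constCode k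
compile (app₁ p e)   = comp (program p) (compile e ∷ [])
compile (app₂ p e f) = comp (program p) (compile e ∷ compile f ∷ [])
compile {n} (sumᴱ b e) = comp (sumBelowCode (compile e)) (compile b ∷ identityProjections n)

compile-evaluates : ∀ {n} (e : Expr n) α xs → Eval α (compile e) xs (⟦ e ⟧ α xs)
compile-evaluates (var i)      α xs = ev-proj
compile-evaluates (lit k)      α xs = eval-const k xs
compile-evaluates (app₁ p e)   α xs = ev-comp (compile-evaluates e α xs ∷ []) (evaluates p α _)
compile-evaluates (app₂ p e f) α xs =
  ev-comp (compile-evaluates e α xs ∷ compile-evaluates f α xs ∷ []) (evaluates p α _)
compile-evaluates (sumᴱ b e)   α xs =
  ev-comp (compile-evaluates b α xs ∷ eval-identityProjections xs)
    (eval-sumBelow (compile e) (⟦ e ⟧ α) (compile-evaluates e α) _ xs)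

toComputable : ∀ {n} → Expr n → Computable n
toComputable e = computable (compile e) ⟦ e ⟧ (compile-evaluates e)

module _ {n} (p : Computable (suc n)) (total : ∀ α xs → ∃ λ w → function p α (w ∷ xs) ≡ 0) where

  private
    zero? : ∀ α xs → U.Decidable (λ w → function p α (w ∷ xs) ≡ 0)
    zero? α xs w = function p α (w ∷ xs) ≟ 0

    leastZero : ∀ α xs → Σ ℕ (LeastWitness.IsLeast (zero? α xs))
    leastZero α xs = LeastWitness.least (zero? α xs) (proj₂ (total α xs))

    positiveRun : ∀ α xs z → function p α (z ∷ xs) ≢ 0 →
                  Σ ℕ λ v → Eval α (program p) (z ∷ xs) (suc v)
    positiveRun α xs z ≢0 with function p α (z ∷ xs) | evaluates p α (z ∷ xs)
    ... | zero  | _   = contradiction refl ≢0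
    ... | suc v | run = v , run

  minimise : Computable n
  minimise = computable (mu (program p)) (λ α xs → proj₁ (leastZero α xs)) λ α xs →
    let (atLeast , belowLeast) = proj₂ (leastZero α xs) in
    ev-mu (subst (Eval α (program p) _) atLeast (evaluates p α _))
          (λ z z<least → positiveRun α xs z (belowLeast z z<least))

  minimise-unique : ∀ α xs w → function p α (w ∷ xs) ≡ 0 →
                    (∀ z → z < w → function p α (z ∷ xs) ≢ 0) → function minimise α xs ≡ w
  minimise-unique α xs w at-w below-w =
    LeastWitness.isLeast-unique (zero? α xs) (proj₂ (leastZero α xs)) (at-w , below-w)

infixl 6 _⊕_ _⊖_
infixl 7 _⊗_
_⊕_ _⊗_ _⊖_ : ∀ {n} → Expr n → Expr n → Expr n
e ⊕ f = app₂ addᶜ e f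
e ⊗ f = app₂ mulᶜ e f
e ⊖ f = app₂ monusᶜ e f

2^ᴱ_ sgᴱ oracleᴱ : ∀ {n} → Expr n → Expr n
2^ᴱ e     = app₁ pow2ᶜ e
sgᴱ e     = app₁ sgᶜ e
oracleᴱ e = app₁ oracleᶜ e

distᴱ eqᴱ ltᴱ : ∀ {n} → Expr n → Expr n → Expr n
distᴱ e f = (e ⊖ f) ⊕ (f ⊖ e)
eqᴱ e f   = lit 1 ⊖ distᴱ e f
ltᴱ e f   = lit 1 ⊖ (lit 1 ⊕ e ⊖ f)

v₀ : ∀ {n} → Expr (suc n)
v₀ = var fz

v₁ : ∀ {n} → Expr (suc (suc n))
v₁ = var (fs fz)

v₂ : ∀ {n} → Expr (suc (suc (suc n)))
v₂ = var (fs (fs fz))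

pairᶜ : Computable 2
pairᶜ = toComputable (2^ᴱ v₀ ⊗ (lit 2 ⊗ v₁ ⊕ lit 1) ⊖ lit 1)

pairᴱ : ∀ {n} → Expr n → Expr n → Expr n
pairᴱ e f = app₂ pairᶜ e f

private
  2n+1-nonZero : ∀ n → NonZero (2 * n + 1)
  2n+1-nonZero n = >-nonZero (m≤n+m 1 (2 * n))

suc-pair : ∀ m n → suc (pair m n) ≡ 2 ^ m * (2 * n + 1)
suc-pair m n = suc-pred (2 ^ m * (2 * n + 1)) {{m*n≢0 (2 ^ m) (2 * n + 1) {{m^n≢0 2 m}} {{2n+1-nonZero n}}}}

m<suc[pair[m,n]] : ∀ m n → m < suc (pair m n)
m<suc[pair[m,n]] m n = ≤-trans (n<2^n m) (≤-trans (m≤m*n (2 ^ m) (2 * n + 1) {{2n+1-nonZero n}})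
  (≤-reflexive (sym (suc-pair m n))))

n≤pair[m,n] : ∀ m n → n ≤ pair m n
n≤pair[m,n] m n = s≤s⁻¹ (≤-trans n<2n+1 (≤-trans (m≤n*m (2 * n + 1) (2 ^ m) {{m^n≢0 2 m}})
  (≤-reflexive (sym (suc-pair m n)))))
  where
  n<2n+1 : n < 2 * n + 1
  n<2n+1 = ≤-trans (s≤s (m≤m+n n (n + 0))) (≤-reflexive (+-comm 1 (2 * n)))

pair-monoʳ-< : ∀ m {n o} → n < o → pair m n < pair m o
pair-monoʳ-< m {n} {o} n<o = s≤s⁻¹ (subst₂ _<_ (sym (suc-pair m n)) (sym (suc-pair m o))
  (*-monoʳ-< (2 ^ m) {{m^n≢0 2 m}} (+-monoˡ-< 1 (*-monoʳ-< 2 n<o))))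

pair-injectiveˡ : ∀ a b c d → pair a b ≡ pair c d → a ≡ c
pair-injectiveˡ a b c d eq = go a c (begin
  2 ^ a * suc (2 * b)   ≡⟨ cong (2 ^ a *_) (+-comm 1 (2 * b)) ⟩
  2 ^ a * (2 * b + 1)   ≡⟨ sym (suc-pair a b) ⟩
  suc (pair a b)        ≡⟨ cong suc eq ⟩
  suc (pair c d)        ≡⟨ suc-pair c d ⟩
  2 ^ c * (2 * d + 1)   ≡⟨ cong (2 ^ c *_) (+-comm (2 * d) 1) ⟩
  2 ^ c * suc (2 * d)   ∎)
  where
  go : ∀ a c → 2 ^ a * suc (2 * b) ≡ 2 ^ c * suc (2 * d) → a ≡ c
  go zero    zero    _  = refl
  go zero    (suc c) eq = contradiction (trans (sym (*-assoc 2 (2 ^ c) _)) (trans (sym eq) (+-identityʳ _)))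
                                        (even≢odd (2 ^ c * suc (2 * d)) b)
  go (suc a) zero    eq = contradiction (trans (sym (*-assoc 2 (2 ^ a) _)) (trans eq (+-identityʳ _)))
                                        (even≢odd (2 ^ a * suc (2 * b)) d)
  go (suc a) (suc c) eq = cong suc (go a c
    (*-cancelˡ-≡ _ _ 2 (trans (sym (*-assoc 2 (2 ^ a) _)) (trans eq (*-assoc 2 (2 ^ c) _)))))

-- sndGiven a x is the least w with x ≤ pair a w, which is b when x = pair a b.
private
  sndGivenPred : Computable 3
  sndGivenPred = toComputable (v₂ ⊖ pairᴱ v₁ v₀)

  sndGiven-total : ∀ α xs → ∃ λ w → function sndGivenPred α (w ∷ xs) ≡ 0
  sndGiven-total _ (a ∷ x ∷ []) = x , m≤n⇒m∸n≡0 (n≤pair[m,n] a x)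

sndGivenᶜ : Computable 2
sndGivenᶜ = minimise sndGivenPred sndGiven-total

sndGiven-pair : ∀ α a b → function sndGivenᶜ α (a ∷ pair a b ∷ []) ≡ b
sndGiven-pair α a b = minimise-unique sndGivenPred sndGiven-total α (a ∷ pair a b ∷ []) b
  (n∸n≡0 (pair a b)) (λ z z<b → m>n⇒m∸n≢0 (pair-monoʳ-< a z<b))

-- fst x is the least z with pair z (sndGiven z x) = x. The factor (1 + x) ∸ z
-- vanishes at z = 1 + x, so the search is total without knowing that every x
-- is of the form pair a b.
private
  fstMismatchᴱ : Expr 2
  fstMismatchᴱ = distᴱ (pairᴱ v₀ (app₂ sndGivenᶜ v₀ v₁)) v₁

  fstPred : Computable 2
  fstPred = toComputable (fstMismatchᴱ ⊗ (lit 1 ⊕ v₁ ⊖ v₀))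

  fst-total : ∀ α xs → ∃ λ w → function fstPred α (w ∷ xs) ≡ 0
  fst-total α (x ∷ []) = suc x , trans (cong (mismatch *_) (n∸n≡0 x)) (*-zeroʳ mismatch)
    where mismatch = ⟦ fstMismatchᴱ ⟧ α (suc x ∷ x ∷ [])

fstᶜ : Computable 1
fstᶜ = minimise fstPred fst-total

fst-pair : ∀ α a b → function fstᶜ α (pair a b ∷ []) ≡ a
fst-pair α a b = minimise-unique fstPred fst-total α (pair a b ∷ []) a at-a below-a
  where
  at-a : function fstPred α (a ∷ pair a b ∷ []) ≡ 0
  at-a rewrite sndGiven-pair α a b | n∸n≡0 (pair a b) = refl

  below-a : ∀ z → z < a → function fstPred α (z ∷ pair a b ∷ []) ≢ 0
  below-a z z<a = m≢0∧n≢0⇒m*n≢0 {⟦ fstMismatchᴱ ⟧ α (z ∷ pair a b ∷ [])}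
    (λ mismatch≡0 → <⇒≢ z<a (pair-injectiveˡ z b′ a b (dist≡0⇒≡ _ _ mismatch≡0)))
    (m>n⇒m∸n≢0 (<-trans z<a (m<suc[pair[m,n]] a b)))
    where b′ = function sndGivenᶜ α (z ∷ pair a b ∷ [])

sndᶜ : Computable 1
sndᶜ = toComputable (app₂ sndGivenᶜ (app₁ fstᶜ v₀) v₀)

snd-pair : ∀ α a b → function sndᶜ α (pair a b ∷ []) ≡ b
snd-pair α a b = trans (cong (λ a′ → function sndGivenᶜ α (a′ ∷ pair a b ∷ [])) (fst-pair α a b))
                       (sndGiven-pair α a b)

⟦_⟧* : ∀ {m k} → Vec (Expr m) k → (ℕ → ℕ) → Vec ℕ m → Vec ℕ k
⟦ es ⟧* α ys = map (λ e → ⟦ e ⟧ α ys) es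

codeᴱ : ∀ {m k} → Vec (Expr m) k → Expr m
codeᴱ []       = lit 0
codeᴱ (e ∷ es) = pairᴱ e (codeᴱ es)

⟦codeᴱ⟧ : ∀ {m k} (es : Vec (Expr m) k) α ys → ⟦ codeᴱ es ⟧ α ys ≡ code (⟦ es ⟧* α ys)
⟦codeᴱ⟧ []       α ys = refl
⟦codeᴱ⟧ (e ∷ es) α ys = cong (pair (⟦ e ⟧ α ys)) (⟦codeᴱ⟧ es α ys)

decodeᴱ : ∀ {m} k → Expr m → Vec (Expr m) k
decodeᴱ zero    e = []
decodeᴱ (suc k) e = app₁ fstᶜ e ∷ decodeᴱ k (app₁ sndᶜ e)

⟦decodeᴱ⟧ : ∀ {m k} (xs : Vec ℕ k) (e : Expr m) α ys →
            ⟦ e ⟧ α ys ≡ code xs → ⟦ decodeᴱ k e ⟧* α ys ≡ xs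
⟦decodeᴱ⟧ []       e α ys _   = refl
⟦decodeᴱ⟧ (x ∷ xs) e α ys e≡ = cong₂ _∷_
  (trans (cong (λ t → function fstᶜ α (t ∷ [])) e≡) (fst-pair α x (code xs)))
  (⟦decodeᴱ⟧ xs (app₁ sndᶜ e) α ys
    (trans (cong (λ t → function sndᶜ α (t ∷ [])) e≡) (snd-pair α x (code xs))))

block : ℕ → ℕ → ℕ
block a b = 2 ^ b ∸ 2 ^ a

blocks : ∀ {k} → Vec ℕ (suc k) → Vec ℕ k
blocks (x ∷ [])     = []
blocks (x ∷ y ∷ xs) = block x y ∷ blocks (y ∷ xs)

[r+2q]/2≡q : ∀ r q → r < 2 → (r + 2 * q) / 2 ≡ q
[r+2q]/2≡q r q r<2 = begin
  (r + 2 * q) / 2    ≡⟨ cong (λ t → (r + t) / 2) (*-comm 2 q) ⟩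
  (r + q * 2) / 2    ≡⟨ +-distrib-/ r (q * 2) remainders<2 ⟩
  r / 2 + q * 2 / 2  ≡⟨ cong₂ _+_ (m<n⇒m/n≡0 r<2) (m*n/n≡m q 2) ⟩
  q                  ∎
  where
  remainders<2 : r % 2 + (q * 2) % 2 < 2
  remainders<2 =
    subst (_< 2) (sym (trans (cong₂ _+_ (m<n⇒m%n≡m r<2) (m*n%n≡0 q 2)) (+-identityʳ r))) r<2

bit-head : ∀ r q → r < 2 → bit (r + 2 * q) 0 ≡ r
bit-head r q r<2 = begin
  (r + 2 * q) % 2  ≡⟨ cong (λ t → (r + t) % 2) (*-comm 2 q) ⟩
  (r + q * 2) % 2  ≡⟨ [m+kn]%n≡m%n r q 2 ⟩
  r % 2            ≡⟨ m<n⇒m%n≡m r<2 ⟩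
  r                ∎

bit-tail : ∀ r q i → r < 2 → bit (r + 2 * q) (suc i) ≡ bit q i
bit-tail r q i r<2 = cong (λ t → bit t i) ([r+2q]/2≡q r q r<2)

bit-zero : ∀ i → bit 0 i ≡ 0
bit-zero zero    = refl
bit-zero (suc i) = bit-zero i

2m∸1≡1+2[m∸1] : ∀ m .{{_ : NonZero m}} → 2 * m ∸ 1 ≡ 1 + 2 * (m ∸ 1)
2m∸1≡1+2[m∸1] (suc k) = +-suc k (k + 0)

block-zero-suc : ∀ b → block 0 (suc b) ≡ 1 + 2 * block 0 b
block-zero-suc b = 2m∸1≡1+2[m∸1] (2 ^ b) {{m^n≢0 2 b}}

block-suc-suc : ∀ a b → block (suc a) (suc b) ≡ 0 + 2 * block a b
block-suc-suc a b = sym (*-distribˡ-∸ 2 (2 ^ b) (2 ^ a))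

1<2 : 1 < 2
1<2 = s≤s (s≤s z≤n)

0<2 : 0 < 2
0<2 = s≤s z≤n

bit-block-inside : ∀ a b i → a ≤ i → i < b → bit (block a b) i ≡ 1
bit-block-inside zero (suc b) zero _ _ = begin
  bit (block 0 (suc b)) 0     ≡⟨ cong (λ t → bit t 0) (block-zero-suc b) ⟩
  bit (1 + 2 * block 0 b) 0   ≡⟨ bit-head 1 (block 0 b) 1<2 ⟩
  1                           ∎
bit-block-inside zero (suc b) (suc i) _ (s≤s i<b) = begin
  bit (block 0 (suc b)) (suc i)    ≡⟨ cong (λ t → bit t (suc i)) (block-zero-suc b) ⟩
  bit (1 + 2 * block 0 b) (suc i)  ≡⟨ bit-tail 1 (block 0 b) i 1<2 ⟩
  bit (block 0 b) i                ≡⟨ bit-block-inside zero b i z≤n i<b ⟩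
  1                                ∎
bit-block-inside (suc a) (suc b) (suc i) (s≤s a≤i) (s≤s i<b) = begin
  bit (block (suc a) (suc b)) (suc i)  ≡⟨ cong (λ t → bit t (suc i)) (block-suc-suc a b) ⟩
  bit (0 + 2 * block a b) (suc i)      ≡⟨ bit-tail 0 (block a b) i 0<2 ⟩
  bit (block a b) i                    ≡⟨ bit-block-inside a b i a≤i i<b ⟩
  1                                    ∎

bit-block-below : ∀ a b i → a ≤ b → i < a → bit (block a b) i ≡ 0
bit-block-below (suc a) (suc b) zero _ _ =
  trans (cong (λ t → bit t 0) (block-suc-suc a b)) (bit-head 0 (block a b) 0<2)
bit-block-below (suc a) (suc b) (suc i) (s≤s a≤b) (s≤s i<a) =
  trans (cong (λ t → bit t (suc i)) (block-suc-suc a b))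
    (trans (bit-tail 0 (block a b) i 0<2) (bit-block-below a b i a≤b i<a))

bit-block-above : ∀ a b i → a ≤ b → b ≤ i → bit (block a b) i ≡ 0
bit-block-above zero zero i _ _ = bit-zero i
bit-block-above zero (suc b) (suc i) _ (s≤s b≤i) =
  trans (cong (λ t → bit t (suc i)) (block-zero-suc b))
    (trans (bit-tail 1 (block 0 b) i 1<2) (bit-block-above zero b i z≤n b≤i))
bit-block-above (suc a) (suc b) (suc i) (s≤s a≤b) (s≤s b≤i) =
  trans (cong (λ t → bit t (suc i)) (block-suc-suc a b))
    (trans (bit-tail 0 (block a b) i 0<2) (bit-block-above a b i a≤b b≤i))

block-apart : ∀ {a b c} → a < b → b < c → MuLtLambda (block a b) (block b c)
block-apart {a} {suc b} {c} (s≤s a≤b) b<c = b , suc b ,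
  (bit-block-inside a (suc b) b a≤b ≤-refl , λ i b<i → bit-block-above a (suc b) i (m≤n⇒m≤1+n a≤b) b<i) ,
  (bit-block-inside (suc b) c (suc b) ≤-refl b<c , λ i i<b → bit-block-below (suc b) c i (<⇒≤ b<c) i<b) ,
  ≤-refl

block[n,1+n]≡2^n : ∀ n → block n (suc n) ≡ 2 ^ n
block[n,1+n]≡2^n n = trans (m+n∸m≡n (2 ^ n) (2 ^ n + 0)) (+-identityʳ (2 ^ n))

b≤block : ∀ {a b} → a < b → b ≤ block a b
b≤block {a} {suc b} (s≤s a≤b) =
  ≤-trans (n<2^n b) (≤-trans (≤-reflexive (sym (block[n,1+n]≡2^n b)))
                             (∸-monoʳ-≤ (2 ^ suc b) (^-monoʳ-≤ 2 a≤b)))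

block-< : ∀ {a b c} → a < b → b < c → block a b < block b c
block-< {a} {b} a<b b<c = <-≤-trans (∸-monoʳ-< (m^n>0 2 a) (^-monoʳ-≤ 2 (<⇒≤ a<b)))
  (≤-trans (≤-reflexive (sym (block[n,1+n]≡2^n b))) (∸-monoˡ-≤ (2 ^ b) (^-monoʳ-≤ 2 b<c)))

block-telescope : ∀ {a b c} → a ≤ b → b ≤ c → block a b + block b c ≡ block a c
block-telescope {a} {b} {c} a≤b b≤c = begin
  block a b + block b c        ≡⟨ +-comm (block a b) (block b c) ⟩
  block b c + block a b        ≡⟨ sym (+-∸-assoc (block b c) (^-monoʳ-≤ 2 a≤b)) ⟩
  (block b c + 2 ^ b) ∸ 2 ^ a  ≡⟨ cong (_∸ 2 ^ a) (m∸n+n≡m (^-monoʳ-≤ 2 b≤c)) ⟩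
  block a c                    ∎

blocksᴱ : ∀ {m k} → Vec (Expr m) (suc k) → Vec (Expr m) k
blocksᴱ (e ∷ [])     = []
blocksᴱ (e ∷ f ∷ es) = (2^ᴱ f ⊖ 2^ᴱ e) ∷ blocksᴱ (f ∷ es)

⟦blocksᴱ⟧ : ∀ {m k} (es : Vec (Expr m) (suc k)) α ys →
            ⟦ blocksᴱ es ⟧* α ys ≡ blocks (⟦ es ⟧* α ys)
⟦blocksᴱ⟧ (e ∷ [])     α ys = refl
⟦blocksᴱ⟧ (e ∷ f ∷ es) α ys = cong (_ ∷_) (⟦blocksᴱ⟧ (f ∷ es) α ys)

-- Read through colour, this is the colouring xs ↦ α (blocks xs) of (n+1)-tuples;
-- the factor sg x keeps the number of colours α 0 at x = 0.
liftedᴱ : ℕ → Expr 1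
liftedᴱ n = oracleᴱ (sgᴱ v₀ ⊗ (lit 1 ⊕ codeᴱ (blocksᴱ (decodeᴱ (suc n) (v₀ ⊖ lit 1)))))

lifted : ℕ → (ℕ → ℕ) → ℕ → ℕ
lifted n α x = ⟦ liftedᴱ n ⟧ α (x ∷ [])

colour-lifted : ∀ n α (xs : Vec ℕ (suc n)) → colour (lifted n α) xs ≡ colour α (blocks xs)
colour-lifted n α xs = begin
  α (1 * suc (⟦ codeᴱ (blocksᴱ es) ⟧ α ys))  ≡⟨ cong α (*-identityˡ _) ⟩
  α (suc (⟦ codeᴱ (blocksᴱ es) ⟧ α ys))      ≡⟨ cong (α ∘ suc) (⟦codeᴱ⟧ (blocksᴱ es) α ys) ⟩
  α (suc (code (⟦ blocksᴱ es ⟧* α ys)))      ≡⟨ cong (α ∘ suc ∘ code) (⟦blocksᴱ⟧ es α ys) ⟩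
  α (suc (code (blocks (⟦ es ⟧* α ys))))     ≡⟨ cong (α ∘ suc ∘ code ∘ blocks) (⟦decodeᴱ⟧ xs _ α ys refl) ⟩
  α (suc (code (blocks xs)))                 ∎
  where
  ys = suc (code xs) ∷ []
  es = decodeᴱ (suc n) (v₀ ⊖ lit 1)

strictlyIncreasing⇒< : ∀ {f} → StrictlyIncreasing f → ∀ {i j} → i < j → f i < f j
strictlyIncreasing⇒< f-inc {i} {suc j} i<1+j with m≤n⇒m<n∨m≡n (s≤s⁻¹ i<1+j)
... | inj₁ i<j  = <-trans (strictlyIncreasing⇒< f-inc i<j) (f-inc j)
... | inj₂ refl = f-inc i

strictlyIncreasing⇒≤ : ∀ {f} → StrictlyIncreasing f → ∀ {i j} → i ≤ j → f i ≤ f j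
strictlyIncreasing⇒≤ f-inc i≤j with m≤n⇒m<n∨m≡n i≤j
... | inj₁ i<j  = <⇒≤ (strictlyIncreasing⇒< f-inc i<j)
... | inj₂ refl = ≤-refl

strictlyIncreasing⇒n≤f[n] : ∀ {f} → StrictlyIncreasing f → ∀ n → n ≤ f n
strictlyIncreasing⇒n≤f[n] f-inc zero    = z≤n
strictlyIncreasing⇒n≤f[n] f-inc (suc n) = <-≤-trans (s≤s (strictlyIncreasing⇒n≤f[n] f-inc n)) (f-inc n)

module BlockSequence {f : ℕ → ℕ} (f-inc : StrictlyIncreasing f) where

  blockSeq : ℕ → ℕ
  blockSeq i = block (f i) (f (suc i))

  blockSeq-increasing : StrictlyIncreasing blockSeq
  blockSeq-increasing i = block-< (f-inc i) (f-inc (suc i))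

  blockSeq-apart : Apart blockSeq
  blockSeq-apart i = block-apart (f-inc i) (f-inc (suc i))

  sumFrom-blockSeq : ∀ a l → sumFrom blockSeq a l ≡ block (f a) (f (a + l))
  sumFrom-blockSeq a zero    rewrite +-identityʳ a = sym (n∸n≡0 (2 ^ f a))
  sumFrom-blockSeq a (suc l) = begin
    blockSeq a + sumFrom blockSeq (suc a) l
      ≡⟨ cong (blockSeq a +_) (sumFrom-blockSeq (suc a) l) ⟩
    block (f a) (f (suc a)) + block (f (suc a)) (f (suc a + l))
      ≡⟨ block-telescope (<⇒≤ (f-inc a)) (strictlyIncreasing⇒≤ f-inc (m≤m+n (suc a) l)) ⟩
    block (f a) (f (suc a + l))
      ≡⟨ cong (block (f a) ∘ f) (sym (+-suc a l)) ⟩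
    block (f a) (f (a + suc l)) ∎

  intervalSum-blockSeq : ∀ {a b} → a ≤ b → intervalSum blockSeq a b ≡ block (f a) (f (suc b))
  intervalSum-blockSeq {a} {b} a≤b =
    trans (sumFrom-blockSeq a (suc b ∸ a)) (cong (block (f a) ∘ f) (m+[n∸m]≡n (m≤n⇒m≤1+n a≤b)))

  endpoints : ∀ {k} → ℕ → Vec ℕ k → Vec ℕ (suc k)
  endpoints k₀ ks = f k₀ ∷ map (f ∘ suc) ks

  afsTuple-blockSeq : ∀ {k} k₀ (ks : Vec ℕ k) → Bounds k₀ ks →
                      afsTuple blockSeq k₀ ks ≡ blocks (endpoints k₀ ks)
  afsTuple-blockSeq k₀ []        _                = refl
  afsTuple-blockSeq k₀ (k₁ ∷ ks) (k₀≤k₁ , bounds) =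
    cong₂ _∷_ (intervalSum-blockSeq k₀≤k₁) (afsTuple-blockSeq (suc k₁) ks bounds)

  endpoints-increasing : ∀ {k} k₀ (ks : Vec ℕ k) → Bounds k₀ ks → Increasing (endpoints k₀ ks)
  endpoints-increasing k₀ []        _                = tt
  endpoints-increasing k₀ (k₁ ∷ ks) (k₀≤k₁ , bounds) =
    strictlyIncreasing⇒< f-inc (s≤s k₀≤k₁) , endpoints-increasing (suc k₁) ks bounds

  endpoints-all : ∀ {P : ℕ → Set} → (∀ i → P (f i)) →
                  ∀ {k} k₀ (ks : Vec ℕ k) → All P (endpoints k₀ ks)
  endpoints-all Pf k₀ ks = Pf k₀ ∷ map⁺ (universal (Pf ∘ suc) ks)

Consecutive : (ℕ → Bool) → ℕ → ℕ → Set
Consecutive Y a b = a < b × Y a ≡ true × Y b ≡ true × (∀ c → a < c → c < b → Y c ≢ true)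

module Enumeration {Y : ℕ → Bool} (Y-infinite : Infinite Y) where

  private
    AtLeast : ℕ → ℕ → Set
    AtLeast m x = m ≤ x × Y x ≡ true

    atLeast? : ∀ m → U.Decidable (AtLeast m)
    atLeast? m x = (m ≤? x) ×-dec (Y x Bool.≟ true)

    module Least m = LeastWitness (atLeast? m)

  nth lowerBound : ℕ → ℕ
  nth i = proj₁ (Least.least (lowerBound i) (proj₂ (Y-infinite (lowerBound i))))
  lowerBound zero    = 0
  lowerBound (suc i) = suc (nth i)

  private
    nth-isLeast : ∀ i → Least.IsLeast (lowerBound i) (nth i)
    nth-isLeast i = proj₂ (Least.least (lowerBound i) (proj₂ (Y-infinite (lowerBound i))))

  nth-∈ : ∀ i → Y (nth i) ≡ true
  nth-∈ i = proj₂ (proj₁ (nth-isLeast i))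

  nth-increasing : StrictlyIncreasing nth
  nth-increasing i = proj₁ (proj₁ (nth-isLeast (suc i)))

  nth-consecutive : ∀ i → Consecutive Y (nth i) (nth (suc i))
  nth-consecutive i = nth-increasing i , nth-∈ i , nth-∈ (suc i) ,
    λ c nth-i<c c<nth-1+i c∈Y → proj₂ (nth-isLeast (suc i)) c c<nth-1+i (nth-i<c , c∈Y)

  nth-surjective : ∀ {x} → Y x ≡ true → ∃ λ i → nth i ≡ x
  nth-surjective {x} x∈Y =
    below (suc x) (<-≤-trans (n<1+n x) (strictlyIncreasing⇒n≤f[n] nth-increasing (suc x)))
    where
    below : ∀ i → x < nth i → ∃ λ j → nth j ≡ x
    below zero    x<nth-0 = contradiction (z≤n , x∈Y) (proj₂ (nth-isLeast 0) x x<nth-0)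
    below (suc i) x<nth-1+i with <-cmp x (nth i)
    ... | tri< x<nth-i _ _ = below i x<nth-i
    ... | tri≈ _ x≡nth-i _ = i , sym x≡nth-i
    ... | tri> _ _ nth-i<x =
      contradiction x∈Y (proj₂ (proj₂ (proj₂ (nth-consecutive i))) x nth-i<x x<nth-1+i)

  consecutive⇒nth : ∀ {a b} → Consecutive Y a b → ∃ λ i → nth i ≡ a × nth (suc i) ≡ b
  consecutive⇒nth {a} {b} (a<b , a∈Y , b∈Y , gap) with nth-surjective a∈Y
  ... | i , refl = i , refl , Least.isLeast-unique (lowerBound (suc i)) (nth-isLeast (suc i))
                               ((a<b , b∈Y) , λ c c<b (a<c , c∈Y) → gap c a<c c<b c∈Y)

χ≢0⇒∈ : ∀ Y {a} → χ Y a ≢ 0 → Y a ≡ true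
χ≢0⇒∈ Y {a} χ≢0 with Y a
... | true  = refl
... | false = contradiction refl χ≢0

χ-∈ : ∀ Y {a} → Y a ≡ true → χ Y a ≡ 1
χ-∈ Y a∈Y rewrite a∈Y = refl

χ-∉ : ∀ Y {a} → Y a ≢ true → χ Y a ≡ 0
χ-∉ Y {a} a∉Y with Y a
... | true  = contradiction refl a∉Y
... | false = refl

0<ᵇn⇒n≢0 : ∀ {n} → (0 <ᵇ n) ≡ true → n ≢ 0
0<ᵇn⇒n≢0 {suc n} _ ()

n≢0⇒0<ᵇn : ∀ {n} → n ≢ 0 → (0 <ᵇ n) ≡ true
n≢0⇒0<ᵇn {zero}  n≢0 = contradiction refl n≢0
n≢0⇒0<ᵇn {suc n} _   = refl

-- Indicators by truncated subtraction: 1 ∸ (suc a ∸ c) is [a < c], and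
-- 1 ∸ ((u ∸ x) + (x ∸ u)) is [u ≡ x].
between : (ℕ → Bool) → ℕ → ℕ → ℕ
between Y a b = sumBelow b (λ c → (1 ∸ (suc a ∸ c)) * χ Y c)

witness : (ℕ → Bool) → ℕ → ℕ → ℕ → ℕ
witness Y x a b = (1 ∸ ((block a b ∸ x) + (x ∸ block a b))) * χ Y a * χ Y b * (1 ∸ between Y a b)

-- Searching b below 1 + x suffices because b ≤ block a b (b≤block).
blockCount : (ℕ → Bool) → ℕ → ℕ
blockCount Y x = sumBelow (suc x) λ b → sumBelow b λ a → witness Y x a b

blockSet : (ℕ → Bool) → ℕ → Bool
blockSet Y x = 0 <ᵇ blockCount Y x

blockSetᶜ : Computable 1
blockSetᶜ = toComputable (sgᴱ (sumᴱ (lit 1 ⊕ v₀) (sumᴱ v₀ witnessᴱ)))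
  where
  betweenᴱ witnessᴱ : Expr 3
  betweenᴱ = sumᴱ v₁ (ltᴱ v₁ v₀ ⊗ oracleᴱ v₀)
  witnessᴱ = eqᴱ (2^ᴱ v₁ ⊖ 2^ᴱ v₀) v₂ ⊗ oracleᴱ v₀ ⊗ oracleᴱ v₁ ⊗ (lit 1 ⊖ betweenᴱ)

blockSetᶜ-computes : ∀ Y → Computes (χ Y) (program blockSetᶜ) (χ (blockSet Y))
blockSetᶜ-computes Y x = evaluates blockSetᶜ (χ Y) (x ∷ [])

between≡0⇒gap : ∀ Y {a b} → between Y a b ≡ 0 → ∀ c → a < c → c < b → Y c ≢ true
between≡0⇒gap Y {a} {b} between≡0 c a<c c<b c∈Y = term≢0 (sumBelow≡0⇒ b _ between≡0 c c<b)
  where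
  term≢0 : (1 ∸ (suc a ∸ c)) * χ Y c ≢ 0
  term≢0 rewrite m≤n⇒m∸n≡0 a<c | χ-∈ Y c∈Y = λ ()

gap⇒between≡0 : ∀ Y {a b} → (∀ c → a < c → c < b → Y c ≢ true) → between Y a b ≡ 0
gap⇒between≡0 Y {a} {b} gap = sumBelow≡0⇐ b _ term≡0
  where
  term≡0 : ∀ c → c < b → (1 ∸ (suc a ∸ c)) * χ Y c ≡ 0
  term≡0 c c<b with a <? c
  ... | yes a<c rewrite χ-∉ Y (gap c a<c c<b) = *-zeroʳ (1 ∸ (suc a ∸ c))
  ... | no  a≮c = trans (cong (λ d → (1 ∸ d) * χ Y c) (+-∸-assoc 1 (≮⇒≥ a≮c)))
                        (cong (_* χ Y c) (0∸n≡0 (a ∸ c)))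

witness≢0⇒ : ∀ Y {x a b} → witness Y x a b ≢ 0 →
             block a b ≡ x × Y a ≡ true × Y b ≡ true × between Y a b ≡ 0
witness≢0⇒ Y {x} {a} {b} witness≢0 =
  let (same·a·b≢0 , gap≢0) = m*n≢0⇒m≢0∧n≢0 (same * χ Y a * χ Y b) witness≢0
      (same·a≢0 , b≢0)     = m*n≢0⇒m≢0∧n≢0 (same * χ Y a) same·a·b≢0
      (same≢0 , a≢0)       = m*n≢0⇒m≢0∧n≢0 same same·a≢0
  in dist≡0⇒≡ (block a b) x (1∸n≢0⇒n≡0 _ same≢0) , χ≢0⇒∈ Y a≢0 , χ≢0⇒∈ Y b≢0 ,
     1∸n≢0⇒n≡0 _ gap≢0
  where same = 1 ∸ ((block a b ∸ x) + (x ∸ block a b))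

witness≢0⇐ : ∀ Y {a b} → Consecutive Y a b → witness Y (block a b) a b ≢ 0
witness≢0⇐ Y {a} {b} (_ , a∈Y , b∈Y , gap) =
  m≢0∧n≢0⇒m*n≢0
    (m≢0∧n≢0⇒m*n≢0 (m≢0∧n≢0⇒m*n≢0 same≢0 (≡1⇒≢0 (χ-∈ Y a∈Y))) (≡1⇒≢0 (χ-∈ Y b∈Y)))
    gap≢0
  where
  ≡1⇒≢0 : ∀ {n} → n ≡ 1 → n ≢ 0
  ≡1⇒≢0 refl = λ ()

  same≢0 : 1 ∸ ((block a b ∸ block a b) + (block a b ∸ block a b)) ≢ 0
  same≢0 rewrite n∸n≡0 (block a b) = λ ()

  gap≢0 : 1 ∸ between Y a b ≢ 0
  gap≢0 rewrite gap⇒between≡0 Y gap = λ ()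

blockCount≢0⇒ : ∀ Y {x} → blockCount Y x ≢ 0 → ∃ λ a → ∃ λ b → Consecutive Y a b × block a b ≡ x
blockCount≢0⇒ Y {x} blockCount≢0 =
  let (b , _ , inner≢0)                     = sumBelow≢0⇒ (suc x) _ blockCount≢0
      (a , a<b , witness≢0)                 = sumBelow≢0⇒ b _ inner≢0
      (block≡x , a∈Y , b∈Y , between≡0)     = witness≢0⇒ Y witness≢0
  in a , b , (a<b , a∈Y , b∈Y , between≡0⇒gap Y between≡0) , block≡x

consecutive⇒blockCount≢0 : ∀ Y {a b} → Consecutive Y a b → blockCount Y (block a b) ≢ 0
consecutive⇒blockCount≢0 Y {a} {b} consecutive@(a<b , _) =
  sumBelow≢0⇐ (suc (block a b)) _ (s≤s (b≤block a<b)) (sumBelow≢0⇐ b _ a<b (witness≢0⇐ Y consecutive))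

module BlockSet {Y : ℕ → Bool} (Y-infinite : Infinite Y) where
  open Enumeration Y-infinite
  open BlockSequence nth-increasing public

  blockSeq∈blockSet : ∀ i → blockSet Y (blockSeq i) ≡ true
  blockSeq∈blockSet i = n≢0⇒0<ᵇn (consecutive⇒blockCount≢0 Y (nth-consecutive i))

  blockSet⊆blockSeq : ∀ {x} → blockSet Y x ≡ true → ∃ λ i → blockSeq i ≡ x
  blockSet⊆blockSeq x∈ =
    let (a , b , consecutive , block≡x) = blockCount≢0⇒ Y (0<ᵇn⇒n≢0 x∈)
        (i , nth-i≡a , nth-1+i≡b)       = consecutive⇒nth consecutive
    in i , trans (cong₂ block nth-i≡a nth-1+i≡b) block≡x

  blockSeq-enumerates : Enumerates blockSeq (blockSet Y)
  blockSeq-enumerates =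
    blockSeq-increasing , λ x → blockSet⊆blockSeq , λ { (i , refl) → blockSeq∈blockSet i }

  blockSet-infinite : Infinite (blockSet Y)
  blockSet-infinite m =
    blockSeq m , strictlyIncreasing⇒n≤f[n] blockSeq-increasing m , blockSeq∈blockSet m

  endpoints-∈ : ∀ {k} k₀ (ks : Vec ℕ k) → All (λ x → Y x ≡ true) (endpoints k₀ ks)
  endpoints-∈ = endpoints-all nth-∈

module _ (n : ℕ) (α : ℕ → ℕ) where

  lifted-instance : Inst (apAHT n) α → Inst (RT (suc n)) (lifted n α)
  lifted-instance α-instance xs _ = subst (_< α 0) (sym (colour-lifted n α xs)) (α-instance (blocks xs))

  blockSet-solution : ∀ {Y} → Sol (RT (suc n)) (lifted n α) Y → Sol (apAHT n) α (blockSet Y)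
  blockSet-solution {Y} (Y-infinite , i , Y-homogeneous) =
    blockSet-infinite , blockSeq , blockSeq-enumerates , blockSeq-apart , i , afs-monochromatic
    where
    open BlockSet Y-infinite

    afs-monochromatic : ∀ k₀ (ks : Vec ℕ n) → Bounds k₀ ks → colour α (afsTuple blockSeq k₀ ks) ≡ i
    afs-monochromatic k₀ ks bounds = begin
      colour α (afsTuple blockSeq k₀ ks)     ≡⟨ cong (colour α) (afsTuple-blockSeq k₀ ks bounds) ⟩
      colour α (blocks (endpoints k₀ ks))    ≡⟨ sym (colour-lifted n α (endpoints k₀ ks)) ⟩
      colour (lifted n α) (endpoints k₀ ks)
        ≡⟨ Y-homogeneous _ (endpoints-increasing k₀ ks bounds) (endpoints-∈ k₀ ks) ⟩
      i                                      ∎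

-- The reduction works for n = 0 as well.
mainTheorem8 : (n : ℕ) → 1 ≤ n → apAHT n ≤sW RT (suc n)
mainTheorem8 n _ = compile (liftedᴱ n) , program blockSetᶜ , λ α α-instance →
  lifted n α , (λ x → compile-evaluates (liftedᴱ n) α (x ∷ [])) , lifted-instance n α α-instance ,
  λ Y solution → blockSet Y , blockSetᶜ-computes Y , blockSet-solution n α solution
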